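{- Let $n\ge 3$ and $1\le l\le n-2$ be integers. Set $X=\{2^n-2^j : 0\le j\le n\}$, $m=(2^{n+1}-1)+(2^n-2^l)$, $Y=m-X=\{m-x : x\in X\}$, $B=X\sqcup Y$, $a=2^n$, and $A=B\sqcup\{a\}$. Then $A$ is a normalised set with $|A+A|=|A-A|+1$ (in particular $|A+A|>|A-A|$).
   Context: For $A\subseteq\mathbb{Z}$, $A+A=\{a_1+a_2 : a_1,a_2\in A\}$ and $A-A=\{a_1-a_2 : a_1,a_2\in A\}$. A finite set $A\subseteq\mathbb{Z}$ is normalised if its smallest element is $0$ and the greatest common divisor of its elements is $1$. -}

module Defs where

open import Data.Nat using (ℕ; suc)
open import Data.Integer using (ℤ; +_; _+_; _-_; _^_; _≤_; 0ℤ; 1ℤ)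
open import Data.Integer.Properties using (_≟_)
open import Data.Integer.GCD using (gcd)
open import Data.List using (List; _∷_; []; map; concatMap; length; deduplicate; upTo; foldr; _++_)
open import Data.List.Membership.Propositional using (_∈_)
open import Data.List.Relation.Unary.All using (All)
open import Data.Product using (_×_)
open import Relation.Binary.PropositionalEquality using (_≡_)

-- Finite sets of integers are represented by lists (duplicates allowed);
-- the set denoted is the set of members, its cardinality is the number
-- of distinct entries.
card : List ℤ → ℕ
card A = length (deduplicate _≟_ A)

sumset : List ℤ → List ℤ
sumset A = concatMap (λ a₁ → map (λ a₂ → a₁ + a₂) A) A

diffset : List ℤ → List ℤ
diffset A = concatMap (λ a₁ → map (λ a₂ → a₁ - a₂) A) A

gcdList : List ℤ → ℤ
gcdList = foldr gcd 0ℤ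

Normalised : List ℤ → Set
Normalised A = (0ℤ ∈ A × All (λ a → 0ℤ ≤ a) A) × gcdList A ≡ 1ℤ

two : ℤ
two = + 2

Xset : ℕ → List ℤ
Xset n = map (λ j → two ^ n - two ^ j) (upTo (suc n))

mval : ℕ → ℕ → ℤ
mval n l = (two ^ suc n - 1ℤ) + (two ^ n - two ^ l)

Yset : ℕ → ℕ → List ℤ
Yset n l = map (λ x → mval n l - x) (Xset n)

Bset : ℕ → ℕ → List ℤ
Bset n l = Xset n ++ Yset n l

Aset : ℕ → ℕ → List ℤ
Aset n l = Bset n l ++ (two ^ n ∷ [])

-- Since Y = m − X, the set B is invariant under b ↦ m − b, so B + B = m + (B − B) and
-- |B + B| = |B − B|. Adjoining a = 2^n creates no new difference, as a − B ⊆ B − B, and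
-- exactly one new sum, 2a: a + B ⊆ B + B, while 2a ∉ B + B. Indeed, writing x_j = 2^n − 2^j
-- and y_j = m − x_j, a sum x_i + x_j is below 2a, a sum y_i + y_j is above it, and
-- x_i + y_j = 2a would mean 2^n + 2^j = 1 + 2^l + 2^i, which is impossible by parity when
-- i, j ≥ 1 and by size otherwise. The gcd is 1 because x_0 − x_1 = 1.

module Submission where

open import Defs
open import Data.Nat using (ℕ; _≤_; _∸_; suc)
open import Data.Product using (_×_)
open import Relation.Binary.PropositionalEquality using (_≡_)

module PowersOfTwo where
  open import Data.Nat using (zero; _+_; _*_; _^_; _<_; s≤s; z≤n)
  open import Data.Nat.Properties
  open import Data.Sum using (inj₁; inj₂)
  open import Relation.Binary.PropositionalEquality using (_≢_; refl; sym; trans; cong)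

  2^k+2^k≡2^[1+k] : ∀ k → 2 ^ k + 2 ^ k ≡ 2 ^ suc k
  2^k+2^k≡2^[1+k] k = cong (2 ^ k +_) (sym (+-identityʳ (2 ^ k)))

  2^i+2^j≢0 : ∀ i j → 2 ^ i + 2 ^ j ≢ 0
  2^i+2^j≢0 i j eq = <⇒≢ (m^n>0 2 i) (sym (m+n≡0⇒m≡0 (2 ^ i) eq))

  2^n+2^n+2^i+2^j≢2^l+2^l+2 : ∀ {l n} i j → l < n → (2 ^ n + 2 ^ n) + (2 ^ i + 2 ^ j) ≢ (2 ^ l + 2 ^ l) + 2
  2^n+2^n+2^i+2^j≢2^l+2^l+2 i j l<n = >⇒≢ (+-mono-<-≤ (+-mono-< 2^l<2^n 2^l<2^n) (+-mono-≤ (m^n>0 2 i) (m^n>0 2 j)))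
    where 2^l<2^n = ^-monoʳ-< 2 (s≤s (s≤s z≤n)) l<n

  2^n+2^j≢1+2^l+2^i : ∀ {l n} i j → 1 ≤ l → 2 + l ≤ n → i ≤ n → 2 ^ n + 2 ^ j ≢ 1 + (2 ^ l + 2 ^ i)
  2^n+2^j≢1+2^l+2^i {suc l} {suc n} (suc i) (suc j) _ _ _ eq = even≢odd (2 ^ n + 2 ^ j) (2 ^ l + 2 ^ i)
    (trans (*-distribˡ-+ 2 (2 ^ n) (2 ^ j)) (trans eq (cong suc (sym (*-distribˡ-+ 2 (2 ^ l) (2 ^ i))))))
  2^n+2^j≢1+2^l+2^i {l} {suc n} zero j 1≤l (s≤s 1+l≤n) _ eq = <⇒≢ (begin-strict
    1 + (2 ^ l + 1)        ≡⟨ cong suc (+-comm (2 ^ l) 1) ⟩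
    2 + 2 ^ l              ≤⟨ +-monoˡ-≤ (2 ^ l) (^-monoʳ-≤ 2 1≤l) ⟩
    2 ^ l + 2 ^ l          ≤⟨ +-mono-≤ 2^l≤2^n 2^l≤2^n ⟩
    2 ^ n + 2 ^ n          ≡⟨ 2^k+2^k≡2^[1+k] n ⟩
    2 ^ suc n              <⟨ m<m+n (2 ^ suc n) (m^n>0 2 j) ⟩
    2 ^ suc n + 2 ^ j      ∎) (sym eq)
    where
    open ≤-Reasoning
    2^l≤2^n = ^-monoʳ-≤ 2 (<⇒≤ 1+l≤n)
  2^n+2^j≢1+2^l+2^i {l} {suc n} (suc i) zero _ (s≤s 1+l≤n) 1+i≤1+n eq
    with 2^n≡2^l+2^i ← suc-injective (trans (+-comm 1 (2 ^ suc n)) eq)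
    with m≤n⇒m<n∨m≡n 1+i≤1+n
  ... | inj₂ refl = <⇒≢ (m<n+m (2 ^ suc i) (m^n>0 2 l)) 2^n≡2^l+2^i
  ... | inj₁ (s≤s 1+i≤n) = <⇒≢ (begin-strict
      2 ^ l + 2 ^ suc i      <⟨ +-mono-<-≤ (^-monoʳ-< 2 (s≤s (s≤s z≤n)) 1+l≤n) (^-monoʳ-≤ 2 1+i≤n) ⟩
      2 ^ n + 2 ^ n          ≡⟨ 2^k+2^k≡2^[1+k] n ⟩
      2 ^ suc n              ∎) (sym 2^n≡2^l+2^i)
    where open ≤-Reasoning

open PowersOfTwo

import Data.Nat as ℕ
open import Data.Nat using (zero; z≤n; s≤s)
import Data.Nat.Properties as ℕ
open import Data.Nat.Properties using (m≤n⇒m<n∨m≡n)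
import Data.Nat.Divisibility as ℕ
open import Data.Integer as ℤ using (ℤ; _+_; _-_; _*_; _^_; 0ℤ; 1ℤ)
open import Data.Integer.Properties using (_≟_; +-0-abelianGroup; +-comm; +-inverseʳ; pos-*; +-injective; i-j≡0⇒i≡j; i≡j⇒i-j≡0; i≤j⇒0≤j-i; +-mono-≤)
open import Data.Integer.GCD using (gcd[i,j]∣i; gcd[i,j]∣j)
open import Data.Integer.Divisibility.Signed using (_∣_; ∣ᵤ⇒∣; ∣⇒∣ᵤ; ∣-trans; ∣m∣n⇒∣m-n)
open import Data.Integer.Tactic.RingSolver using (solve-∀)
open import Algebra.Properties.AbelianGroup +-0-abelianGroup using (⁻¹-anti-homo‿-) renaming (∙-cancelˡ to +-cancelˡ)
open import Data.List using (List; []; _∷_; _++_; [_]; map; concatMap; cartesianProductWith; length; deduplicate)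
open import Data.List.Properties using (length-map)
open import Data.List.Membership.Propositional using (_∈_; _∉_)
open import Data.List.Membership.Propositional.Properties using (∈-++⁻; ∈-++⁺ˡ; ∈-++⁺ʳ; ∈-map⁺; ∈-map⁻; ∈-upTo⁺; ∈-upTo⁻; ∈-deduplicate⁺; ∈-deduplicate⁻; ∈-cartesianProductWith⁺; ∈-cartesianProductWith⁻)
open import Data.List.Membership.Propositional.Properties.WithK using (unique∧set⇒bag)
open import Data.List.Relation.Binary.BagAndSetEquality using (∼bag⇒↭)
open import Data.List.Relation.Binary.Permutation.Propositional.Properties using (↭-length)
open import Data.List.Relation.Binary.Subset.Propositional using (_⊆_)
open import Data.List.Relation.Binary.Subset.Propositional.Properties using (∷⁺ʳ; ∈-∷⁺ʳ; map⁺; xs⊆xs++ys)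
open import Data.List.Relation.Unary.Any using (here; there)
open import Data.List.Relation.Unary.All as All using (All)
open import Data.List.Relation.Unary.AllPairs using (_∷_)
open import Data.List.Relation.Unary.Unique.Propositional using (Unique)
import Data.List.Relation.Unary.Unique.Propositional.Properties as Unique
open import Data.List.Relation.Unary.Unique.DecPropositional.Properties using (deduplicate-!)
open import Data.Sum using (_⊎_; inj₁; inj₂)
open import Data.Product using (_,_; ∃₂)
open import Function using (_∘_; mk⇔)
open import Function.Definitions using (Injective)
open import Relation.Binary.PropositionalEquality using (_≢_; refl; sym; trans; cong; subst; module ≡-Reasoning)

private
  dedup : List ℤ → List ℤ
  dedup = deduplicate _≟_

card≡length : ∀ {xs ys} → Unique ys → xs ⊆ ys → ys ⊆ xs → card xs ≡ length ys
card≡length {xs} u xs⊆ys ys⊆xs = ↭-length (∼bag⇒↭ (unique∧set⇒bag (deduplicate-! _≟_ xs) u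
  (mk⇔ (xs⊆ys ∘ ∈-deduplicate⁻ _≟_ xs) (∈-deduplicate⁺ _≟_ ∘ ys⊆xs))))

card-cong : ∀ {xs ys} → xs ⊆ ys → ys ⊆ xs → card xs ≡ card ys
card-cong {xs} {ys} xs⊆ys ys⊆xs = card≡length (deduplicate-! _≟_ ys)
  (∈-deduplicate⁺ _≟_ ∘ xs⊆ys) (ys⊆xs ∘ ∈-deduplicate⁻ _≟_ ys)

card-∷-∉ : ∀ {x xs} → x ∉ xs → card (x ∷ xs) ≡ suc (card xs)
card-∷-∉ {x} {xs} x∉xs = card≡length (All.tabulate x≢ ∷ deduplicate-! _≟_ xs)
  (∷⁺ʳ x (∈-deduplicate⁺ _≟_)) (∷⁺ʳ x (∈-deduplicate⁻ _≟_ xs))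
  where
  x≢ : ∀ {y} → y ∈ dedup xs → x ≢ y
  x≢ y∈ refl = x∉xs (∈-deduplicate⁻ _≟_ xs y∈)

card-map-injective : ∀ {f : ℤ → ℤ} → Injective _≡_ _≡_ f → ∀ xs → card (map f xs) ≡ card xs
card-map-injective {f} f-inj xs = trans
  (card≡length (Unique.map⁺ f-inj (deduplicate-! _≟_ xs))
    (map⁺ f (∈-deduplicate⁺ _≟_)) (map⁺ f (∈-deduplicate⁻ _≟_ xs)))
  (length-map f (dedup xs))

concatMap-map≡cartesianProductWith : ∀ {A B C : Set} (f : A → B → C) xs ys →
  concatMap (λ x → map (f x) ys) xs ≡ cartesianProductWith f xs ys
concatMap-map≡cartesianProductWith f [] ys = refl
concatMap-map≡cartesianProductWith f (x ∷ xs) ys =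
  cong (map (f x) ys ++_) (concatMap-map≡cartesianProductWith f xs ys)

module _ (A : List ℤ) where

  -- Opaque: otherwise Agda's injectivity analysis unfolds the ring-solver proofs handed
  -- to the `via` lemmas, and checking their callers takes minutes.
  opaque

    ∈-sumset⁺ : ∀ {a b} → a ∈ A → b ∈ A → a + b ∈ sumset A
    ∈-sumset⁺ a∈ b∈ = subst (_ ∈_) (sym (concatMap-map≡cartesianProductWith _+_ A A))
      (∈-cartesianProductWith⁺ _+_ a∈ b∈)

    ∈-sumset⁻ : ∀ {z} → z ∈ sumset A → ∃₂ λ a b → a ∈ A × b ∈ A × z ≡ a + b
    ∈-sumset⁻ z∈ = ∈-cartesianProductWith⁻ _+_ A A
      (subst (_ ∈_) (concatMap-map≡cartesianProductWith _+_ A A) z∈)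

    ∈-diffset⁺ : ∀ {a b} → a ∈ A → b ∈ A → a - b ∈ diffset A
    ∈-diffset⁺ a∈ b∈ = subst (_ ∈_) (sym (concatMap-map≡cartesianProductWith _-_ A A))
      (∈-cartesianProductWith⁺ _-_ a∈ b∈)

    ∈-diffset⁻ : ∀ {z} → z ∈ diffset A → ∃₂ λ a b → a ∈ A × b ∈ A × z ≡ a - b
    ∈-diffset⁻ z∈ = ∈-cartesianProductWith⁻ _-_ A A
      (subst (_ ∈_) (concatMap-map≡cartesianProductWith _-_ A A) z∈)

    ∈-sumset-via : ∀ {a b z} → a ∈ A → b ∈ A → z ≡ a + b → z ∈ sumset A
    ∈-sumset-via a∈ b∈ refl = ∈-sumset⁺ a∈ b∈

    ∈-diffset-via : ∀ {a b z} → a ∈ A → b ∈ A → z ≡ a - b → z ∈ diffset A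
    ∈-diffset-via a∈ b∈ refl = ∈-diffset⁺ a∈ b∈

sumset-mono : ∀ {A A′} → A ⊆ A′ → sumset A ⊆ sumset A′
sumset-mono {A} {A′} A⊆A′ z∈ with a , b , a∈ , b∈ , refl ← ∈-sumset⁻ A z∈ = ∈-sumset⁺ A′ (A⊆A′ a∈) (A⊆A′ b∈)

diffset-mono : ∀ {A A′} → A ⊆ A′ → diffset A ⊆ diffset A′
diffset-mono {A} {A′} A⊆A′ z∈ with a , b , a∈ , b∈ , refl ← ∈-diffset⁻ A z∈ = ∈-diffset⁺ A′ (A⊆A′ a∈) (A⊆A′ b∈)

diffset-neg : ∀ A {z} → z ∈ diffset A → ℤ.- z ∈ diffset A
diffset-neg A z∈ with a , b , a∈ , b∈ , refl ← ∈-diffset⁻ A z∈ =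
  subst (_∈ diffset A) (sym (⁻¹-anti-homo‿- a b)) (∈-diffset⁺ A b∈ a∈)

SymmetricAbout : ℤ → List ℤ → Set
SymmetricAbout m B = ∀ {b} → b ∈ B → m - b ∈ B

module _ (m : ℤ) {B} (symm : SymmetricAbout m B) where

  sumset⊆shifted-diffset : sumset B ⊆ map (m +_) (diffset B)
  sumset⊆shifted-diffset z∈ with a , b , a∈ , b∈ , refl ← ∈-sumset⁻ B z∈ =
    subst (_∈ map (m +_) (diffset B)) (sym (eq m a b)) (∈-map⁺ (m +_) (∈-diffset⁺ B a∈ (symm b∈)))
    where
    eq : ∀ m a b → a + b ≡ m + (a - (m - b))
    eq = solve-∀

  shifted-diffset⊆sumset : map (m +_) (diffset B) ⊆ sumset B
  shifted-diffset⊆sumset z∈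
    with d , d∈ , refl ← ∈-map⁻ (m +_) z∈
    with a , b , a∈ , b∈ , refl ← ∈-diffset⁻ B d∈ =
    subst (_∈ sumset B) (eq m a b) (∈-sumset⁺ B a∈ (symm b∈))
    where
    eq : ∀ m a b → a + (m - b) ≡ m + (a - b)
    eq = solve-∀

  card-sumset≡card-diffset : card (sumset B) ≡ card (diffset B)
  card-sumset≡card-diffset = trans
    (card-cong sumset⊆shifted-diffset shifted-diffset⊆sumset)
    (card-map-injective (+-cancelˡ m _ _) (diffset B))

∈-++-[]⁻ : ∀ {x a : ℤ} B → x ∈ B ++ [ a ] → x ∈ B ⊎ x ≡ a
∈-++-[]⁻ B x∈ with ∈-++⁻ B x∈
... | inj₁ x∈B = inj₁ x∈B
... | inj₂ (here x≡a) = inj₂ x≡a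

module _ {a b₀ B} (m : ℤ) (symm : SymmetricAbout m B) (b₀∈B : b₀ ∈ B)
         (a-B⊆B-B : ∀ {b} → b ∈ B → a - b ∈ diffset B)
         (a+B⊆B+B : ∀ {b} → b ∈ B → a + b ∈ sumset B)
         (a+a∉B+B : a + a ∉ sumset B) where

  private
    A : List ℤ
    A = B ++ [ a ]

    B⊆A : B ⊆ A
    B⊆A = xs⊆xs++ys B [ a ]

    a∈A : a ∈ A
    a∈A = ∈-++⁺ʳ B (here refl)

  diffset-adjoin⊆diffset : diffset A ⊆ diffset B
  diffset-adjoin⊆diffset z∈ with x , y , x∈ , y∈ , refl ← ∈-diffset⁻ A z∈ =
    differences (∈-++-[]⁻ B x∈) (∈-++-[]⁻ B y∈)
    where
    differences : ∀ {x y} → x ∈ B ⊎ x ≡ a → y ∈ B ⊎ y ≡ a → x - y ∈ diffset B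
    differences (inj₁ x∈B) (inj₁ y∈B) = ∈-diffset⁺ B x∈B y∈B
    differences (inj₂ refl) (inj₁ y∈B) = a-B⊆B-B y∈B
    differences {x} (inj₁ x∈B) (inj₂ refl) =
      subst (_∈ diffset B) (⁻¹-anti-homo‿- a x) (diffset-neg B (a-B⊆B-B x∈B))
    differences (inj₂ refl) (inj₂ refl) =
      subst (_∈ diffset B) (trans (+-inverseʳ b₀) (sym (+-inverseʳ a))) (∈-diffset⁺ B b₀∈B b₀∈B)

  sumset-adjoin⊆sumset : sumset A ⊆ (a + a) ∷ sumset B
  sumset-adjoin⊆sumset z∈ with x , y , x∈ , y∈ , refl ← ∈-sumset⁻ A z∈ =
    sums (∈-++-[]⁻ B x∈) (∈-++-[]⁻ B y∈)
    where
    sums : ∀ {x y} → x ∈ B ⊎ x ≡ a → y ∈ B ⊎ y ≡ a → x + y ∈ (a + a) ∷ sumset B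
    sums (inj₁ x∈B) (inj₁ y∈B) = there (∈-sumset⁺ B x∈B y∈B)
    sums (inj₂ refl) (inj₁ y∈B) = there (a+B⊆B+B y∈B)
    sums {x} (inj₁ x∈B) (inj₂ refl) = there (subst (_∈ sumset B) (+-comm a x) (a+B⊆B+B x∈B))
    sums (inj₂ refl) (inj₂ refl) = here refl

  card-adjoin-sumset≡1+card-adjoin-diffset : card (sumset A) ≡ suc (card (diffset A))
  card-adjoin-sumset≡1+card-adjoin-diffset = begin
    card (sumset A)              ≡⟨ card-cong sumset-adjoin⊆sumset
                                      (∈-∷⁺ʳ (∈-sumset⁺ A a∈A a∈A) (sumset-mono B⊆A)) ⟩
    card ((a + a) ∷ sumset B)    ≡⟨ card-∷-∉ a+a∉B+B ⟩
    suc (card (sumset B))        ≡⟨ cong suc (card-sumset≡card-diffset m symm) ⟩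
    suc (card (diffset B))       ≡⟨ cong suc (card-cong diffset-adjoin⊆diffset (diffset-mono B⊆A)) ⟨
    suc (card (diffset A))       ∎
    where open ≡-Reasoning

gcdList-∣ : ∀ {a A} → a ∈ A → gcdList A ∣ a
gcdList-∣ {A = b ∷ bs} (here refl) = ∣ᵤ⇒∣ (gcd[i,j]∣i b (gcdList bs))
gcdList-∣ {A = b ∷ bs} (there a∈) = ∣-trans (∣ᵤ⇒∣ (gcd[i,j]∣j b (gcdList bs))) (gcdList-∣ a∈)

gcdList≡1 : ∀ {a b A} → a ∈ A → b ∈ A → a - b ≡ 1ℤ → gcdList A ≡ 1ℤ
gcdList≡1 {A = c ∷ cs} a∈ b∈ a-b≡1 =
  cong ℤ.+_ (ℕ.∣1⇒≡1 (∣⇒∣ᵤ (subst (_ ∣_) a-b≡1 (∣m∣n⇒∣m-n (gcdList-∣ a∈) (gcdList-∣ b∈)))))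

two^k≡+2^k : ∀ k → two ^ k ≡ ℤ.+ (2 ℕ.^ k)
two^k≡+2^k zero = refl
two^k≡+2^k (suc k) = trans (cong (two *_) (two^k≡+2^k k)) (sym (pos-* 2 (2 ℕ.^ k)))

≡-by-difference : ∀ {u v p q} → p - q ≡ u - v → u ≡ v → p ≡ q
≡-by-difference {p = p} {q} p-q≡u-v u≡v = i-j≡0⇒i≡j p q (trans p-q≡u-v (i≡j⇒i-j≡0 u≡v))

module Construction {n l : ℕ} (1≤l : 1 ≤ l) (2+l≤n : 2 ℕ.+ l ≤ n) where

  N L m : ℤ
  N = two ^ n
  L = two ^ l
  m = mval n l

  x y : ℕ → ℤ
  x j = N - two ^ j
  y j = m - x j

  B : List ℤ
  B = Bset n l

  l≤n : l ≤ n
  l≤n = ℕ.m+n≤o⇒n≤o 2 2+l≤n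

  x∈B : ∀ {j} → j ≤ n → x j ∈ B
  x∈B j≤n = ∈-++⁺ˡ (∈-map⁺ x (∈-upTo⁺ (s≤s j≤n)))

  y∈B : ∀ {j} → j ≤ n → y j ∈ B
  y∈B j≤n = ∈-++⁺ʳ (Xset n) (∈-map⁺ (m -_) (∈-map⁺ x (∈-upTo⁺ (s≤s j≤n))))

  data BView (b : ℤ) : Set where
    isX : ∀ {j} → j ≤ n → b ≡ x j → BView b
    isY : ∀ {j} → j ≤ n → b ≡ y j → BView b

  view : ∀ {b} → b ∈ B → BView b
  view b∈ with ∈-++⁻ (Xset n) b∈
  ... | inj₁ b∈X with j , j∈ , refl ← ∈-map⁻ x b∈X = isX (ℕ.s≤s⁻¹ (∈-upTo⁻ j∈)) refl
  ... | inj₂ b∈Y with _ , x∈X , refl ← ∈-map⁻ (m -_) b∈Y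
                 with j , j∈ , refl ← ∈-map⁻ x x∈X = isY (ℕ.s≤s⁻¹ (∈-upTo⁻ j∈)) refl

  B-symmetric : SymmetricAbout m B
  B-symmetric b∈ with view b∈
  ... | isX j≤n refl = y∈B j≤n
  ... | isY {j} j≤n refl = subst (_∈ B) (sym (m-[m-t]≡t m (x j))) (x∈B j≤n)
    where
    m-[m-t]≡t : ∀ m t → m - (m - t) ≡ t
    m-[m-t]≡t = solve-∀

  -- In the ring identities below, N, L and p stand for 2^n, 2^l and a power 2^j,
  -- and (2N − 1) + (N − L) is m written out.
  N-B⊆B-B : ∀ {b} → b ∈ B → N - b ∈ diffset B
  N-B⊆B-B b∈ with view b∈
  ... | isX {j} j≤n refl with m≤n⇒m<n∨m≡n j≤n
  ...   | inj₁ j<n = ∈-diffset-via B (x∈B j≤n) (x∈B j<n) (N-x≡x-x N (two ^ j))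
    where
    N-x≡x-x : ∀ N p → N - (N - p) ≡ (N - p) - (N - two * p)
    N-x≡x-x = solve-∀
  ...   | inj₂ refl = ∈-diffset-via B (y∈B z≤n) (x∈B l≤n) (N-x≡y-x N L)
    where
    N-x≡y-x : ∀ N L → N - (N - N) ≡ (((two * N - 1ℤ) + (N - L)) - (N - 1ℤ)) - (N - L)
    N-x≡y-x = solve-∀
  N-B⊆B-B b∈ | isY {zero} _ refl = ∈-diffset-via B (x∈B ℕ.≤-refl) (x∈B l≤n) (N-y≡x-x N L)
    where
    N-y≡x-x : ∀ N L → N - (((two * N - 1ℤ) + (N - L)) - (N - 1ℤ)) ≡ (N - N) - (N - L)
    N-y≡x-x = solve-∀
  N-B⊆B-B b∈ | isY {suc k} k<n refl = ∈-diffset-via B (x∈B (ℕ.<⇒≤ k<n)) (y∈B (ℕ.<⇒≤ k<n)) (N-y≡x-y N L (two ^ k))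
    where
    N-y≡x-y : ∀ N L p → N - (((two * N - 1ℤ) + (N - L)) - (N - two * p))
                      ≡ (N - p) - (((two * N - 1ℤ) + (N - L)) - (N - p))
    N-y≡x-y = solve-∀

  N+B⊆B+B : ∀ {b} → b ∈ B → N + b ∈ sumset B
  N+B⊆B+B b∈ with view b∈
  ... | isX {zero} _ refl = ∈-sumset-via B (x∈B ℕ.≤-refl) (y∈B l≤n) (N+x≡x+y N L)
    where
    N+x≡x+y : ∀ N L → N + (N - 1ℤ) ≡ (N - N) + (((two * N - 1ℤ) + (N - L)) - (N - L))
    N+x≡x+y = solve-∀
  ... | isX {suc k} k<n refl = ∈-sumset-via B (x∈B (ℕ.<⇒≤ k<n)) (x∈B (ℕ.<⇒≤ k<n)) (N+x≡x+x N (two ^ k))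
    where
    N+x≡x+x : ∀ N p → N + (N - two * p) ≡ (N - p) + (N - p)
    N+x≡x+x = solve-∀
  ... | isY {j} j≤n refl with m≤n⇒m<n∨m≡n j≤n
  ...   | inj₁ j<n = ∈-sumset-via B (x∈B j≤n) (y∈B j<n) (N+y≡x+y N L (two ^ j))
    where
    N+y≡x+y : ∀ N L p → N + (((two * N - 1ℤ) + (N - L)) - (N - p))
                      ≡ (N - p) + (((two * N - 1ℤ) + (N - L)) - (N - two * p))
    N+y≡x+y = solve-∀
  ...   | inj₂ refl = ∈-sumset-via B (y∈B z≤n) (y∈B l≤n) (N+y≡y+y N L)
    where
    N+y≡y+y : ∀ N L → N + (((two * N - 1ℤ) + (N - L)) - (N - N))
                    ≡ (((two * N - 1ℤ) + (N - L)) - (N - 1ℤ)) + (((two * N - 1ℤ) + (N - L)) - (N - L))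
    N+y≡y+y = solve-∀

  two^i+two^j≢0 : ∀ i j → two ^ i + two ^ j ≢ 0ℤ
  two^i+two^j≢0 i j eq rewrite two^k≡+2^k i | two^k≡+2^k j = 2^i+2^j≢0 i j (+-injective eq)

  N+two^j≢1+L+two^i : ∀ {i} j → i ≤ n → N + two ^ j ≢ 1ℤ + (L + two ^ i)
  N+two^j≢1+L+two^i {i} j i≤n eq rewrite two^k≡+2^k n | two^k≡+2^k j | two^k≡+2^k l | two^k≡+2^k i =
    2^n+2^j≢1+2^l+2^i i j 1≤l 2+l≤n i≤n (+-injective eq)

  N+N+two^i+two^j≢L+L+2 : ∀ i j → (N + N) + (two ^ i + two ^ j) ≢ (L + L) + two
  N+N+two^i+two^j≢L+L+2 i j eq rewrite two^k≡+2^k n | two^k≡+2^k j | two^k≡+2^k l | two^k≡+2^k i =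
    2^n+2^n+2^i+2^j≢2^l+2^l+2 i j (ℕ.m+n≤o⇒n≤o 1 2+l≤n) (+-injective eq)

  N+N∉B+B : N + N ∉ sumset B
  N+N∉B+B z∈ with b₁ , b₂ , b₁∈ , b₂∈ , eq ← ∈-sumset⁻ B z∈ = no-pair (view b₁∈) (view b₂∈) (sym eq)
    where
    no-pair : ∀ {b₁ b₂} → BView b₁ → BView b₂ → b₁ + b₂ ≢ N + N
    no-pair (isX {i} _ refl) (isX {j} _ refl) eq =
      two^i+two^j≢0 i j (sym (≡-by-difference (x+x-2N N (two ^ i) (two ^ j)) eq))
      where
      x+x-2N : ∀ N p q → 0ℤ - (p + q) ≡ ((N - p) + (N - q)) - (N + N)
      x+x-2N = solve-∀
    no-pair (isX {i} i≤n refl) (isY {j} _ refl) eq =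
      N+two^j≢1+L+two^i j i≤n (≡-by-difference (x+y-2N N L (two ^ i) (two ^ j)) eq)
      where
      x+y-2N : ∀ N L p q → (N + q) - (1ℤ + (L + p)) ≡ ((N - p) + (((two * N - 1ℤ) + (N - L)) - (N - q))) - (N + N)
      x+y-2N = solve-∀
    no-pair (isY {j} j≤n refl) (isX {i} i≤n refl) eq = no-pair (isX i≤n refl) (isY j≤n refl) (trans (+-comm (x i) (y j)) eq)
    no-pair (isY {i} _ refl) (isY {j} _ refl) eq =
      N+N+two^i+two^j≢L+L+2 i j (≡-by-difference (y+y-2N N L (two ^ i) (two ^ j)) eq)
      where
      y+y-2N : ∀ N L p q → ((N + N) + (p + q)) - ((L + L) + two)
             ≡ ((((two * N - 1ℤ) + (N - L)) - (N - p)) + (((two * N - 1ℤ) + (N - L)) - (N - q))) - (N + N)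
      y+y-2N = solve-∀

  A : List ℤ
  A = Aset n l

  B⊆A : B ⊆ A
  B⊆A = ∈-++⁺ˡ

  0≤two^ : ∀ k → 0ℤ ℤ.≤ two ^ k
  0≤two^ k rewrite two^k≡+2^k k = ℤ.+≤+ z≤n

  0≤x : ∀ {j} → j ≤ n → 0ℤ ℤ.≤ x j
  0≤x {j} j≤n rewrite two^k≡+2^k n | two^k≡+2^k j = i≤j⇒0≤j-i (ℤ.+≤+ (ℕ.^-monoʳ-≤ 2 j≤n))

  A-nonnegative : All (0ℤ ℤ.≤_) A
  A-nonnegative = All.tabulate nonneg
    where
    y≡x+x+two^ : ∀ N L p → ((two * N - 1ℤ) + (N - L)) - (N - p) ≡ ((N - 1ℤ) + (N - L)) + p
    y≡x+x+two^ = solve-∀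
    nonneg : ∀ {a} → a ∈ A → 0ℤ ℤ.≤ a
    nonneg a∈ with ∈-++⁻ B a∈
    ... | inj₂ (here refl) = 0≤two^ n
    ... | inj₁ a∈B with view a∈B
    ...   | isX j≤n refl = 0≤x j≤n
    ...   | isY {j} j≤n refl = subst (0ℤ ℤ.≤_) (sym (y≡x+x+two^ N L (two ^ j)))
                                 (+-mono-≤ (+-mono-≤ (0≤x z≤n) (0≤x l≤n)) (0≤two^ j))

  A-normalised : Normalised A
  A-normalised = (0∈A , A-nonnegative) , gcdList≡1 (B⊆A (x∈B z≤n)) (B⊆A (x∈B 1≤n)) (x₀-x₁≡1 N)
    where
    1≤n = ℕ.≤-trans 1≤l l≤n
    0∈A = subst (_∈ A) (+-inverseʳ N) (B⊆A (x∈B ℕ.≤-refl))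
    x₀-x₁≡1 : ∀ N → (N - 1ℤ) - (N - two * 1ℤ) ≡ 1ℤ
    x₀-x₁≡1 = solve-∀

  card-A+A≡1+card-A-A : card (sumset A) ≡ suc (card (diffset A))
  card-A+A≡1+card-A-A = card-adjoin-sumset≡1+card-adjoin-diffset m B-symmetric (x∈B z≤n) N-B⊆B-B N+B⊆B+B N+N∉B+B

theorem3 : (n l : ℕ) → 3 ≤ n → 1 ≤ l → l ≤ n ∸ 2 →
    Normalised (Aset n l) × card (sumset (Aset n l)) ≡ suc (card (diffset (Aset n l)))
theorem3 (suc (suc n)) l (s≤s (s≤s _)) 1≤l l≤n = A-normalised , card-A+A≡1+card-A-A
  where open Construction 1≤l (s≤s (s≤s l≤n))
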